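{- Let $\Delta$ be a simplicial complex with vertex set $\{x_1,\dots,x_n\}$ and let $s_1,\dots,s_n$ be positive integers. Then $\Delta$ is strongly shellable if and only if its $(s_1,\dots,s_n)$-expansion $\Delta^{(s_1,\dots,s_n)}$ is strongly shellable.
   Context: A simplicial complex is a finite family of subsets of a vertex set closed under taking subsets; $\mathcal{F}(\Delta)$ is its set of facets. A linear order $F_1,\dots,F_t$ of $\mathcal{F}(\Delta)$ is a strong shelling order if for every $1\le i<j\le t$ there exists $k$ with $1\le k<j$ such that $|F_j\setminus F_k|=1$, $F_j\setminus F_k\subseteq F_j\setminus F_i$, and $F_k\setminus F_j\subseteq F_i$; $\Delta$ is strongly shellable if such an order exists. The $(s_1,\dots,s_n)$-expansion $\Delta^{(s_1,\dots,s_n)}$ is the simplicial complex with vertex set $\{x_{i,j}\mid 1\le i\le n,\ 1\le j\le s_i\}$ whose facet set is $\{\{x_{i_1,r_1},\dots,x_{i_t,r_t}\}\mid \{x_{i_1},\dots,x_{i_t}\}\in\mathcal{F}(\Delta),\ (r_1,\dots,r_t)\in[s_{i_1}]\times\cdots\times[s_{i_t}]\}$. -}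

module Defs where

open import Data.Nat using (ℕ; zero; suc; _≤_)
open import Data.Fin using (Fin; zero; suc; splitAt; _<_)
open import Data.Fin.Subset using (Subset; _∈_; _⊆_; _─_; ∣_∣)
open import Data.Vec using (Vec; []; _∷_; lookup; sum)
open import Data.List using (List; length)
import Data.List as List
open import Data.List.Relation.Unary.Unique.Propositional using (Unique)
import Data.List.Membership.Propositional as LM
open import Data.Product using (Σ; ∃; ∃-syntax; _×_; _,_; proj₁; proj₂)
open import Data.Sum using (_⊎_; inj₁; inj₂)
open import Function.Bundles using (_⇔_)
open import Relation.Binary.PropositionalEquality using (_≡_)
open import Relation.Nullary using (¬_)

-- A simplicial complex on the vertex set Fin n = {x_1,…,x_n}:
-- a family of faces (subsets of the vertex set) closed under subsets.
-- (It is automatically finite since the vertex set is finite.)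
record SimplicialComplex (n : ℕ) : Set₁ where
  field
    IsFace    : Subset n → Set
    downClosed : ∀ {F G} → G ⊆ F → IsFace F → IsFace G

IsFacet : ∀ {n} → SimplicialComplex n → Subset n → Set
IsFacet Δ F = IsFace F × (∀ G → IsFace G → F ⊆ G → G ≡ F)
  where open SimplicialComplex Δ

IsStrongShellingOrder : ∀ {n} → List (Subset n) → Set
IsStrongShellingOrder L =
  ∀ (i j : Fin (length L)) → i < j →
    ∃[ k ] (k < j
           × ∣ F j ─ F k ∣ ≡ 1
           × (F j ─ F k) ⊆ (F j ─ F i)
           × (F k ─ F j) ⊆ F i)
  where F = List.lookup L

StronglyShellableFacets : ∀ {n} → (Subset n → Set) → Set
StronglyShellableFacets {n} Facet =
  ∃[ L ] (Unique L × (∀ F → (F LM.∈ L) ⇔ Facet F) × IsStrongShellingOrder {n} L)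

StronglyShellable : ∀ {n} → SimplicialComplex n → Set
StronglyShellable Δ = StronglyShellableFacets (IsFacet Δ)

-- Vertices of the expansion: x_{i,j}, 1 ≤ i ≤ n, 1 ≤ j ≤ s_i, encoded as
-- Fin (s_1 + … + s_n) in blocks; decode recovers the pair (i , j).
decode : ∀ {n} (s : Vec ℕ n) → Fin (sum s) → Σ (Fin n) (λ i → Fin (lookup s i))
decode (x ∷ s) v with splitAt x v
... | inj₁ j = zero , j
... | inj₂ w with decode s w
...   | (i , j) = suc i , j

-- Facets of the (s_1,…,s_n)-expansion: sets {x_{i,r_i} | x_i ∈ F} for a
-- facet F of Δ and a choice r_i ∈ [s_i] (only r_i for x_i ∈ F matter).
IsExpansionFacet : ∀ {n} → SimplicialComplex n → (s : Vec ℕ n) → Subset (sum s) → Set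
IsExpansionFacet {n} Δ s G =
  ∃[ F ] Σ ((i : Fin n) → Fin (lookup s i)) λ r → (IsFacet Δ F ×
    (∀ v → (v ∈ G) ⇔ (proj₁ (decode s v) ∈ F
                      × proj₂ (decode s v) ≡ r (proj₁ (decode s v)))))

ExpansionStronglyShellable : ∀ {n} → SimplicialComplex n → Vec ℕ n → Set
ExpansionStronglyShellable Δ s = StronglyShellableFacets (IsExpansionFacet Δ s)

-- A strong shelling order of Δ lifts to the expansion: list the expanded facets
-- {x_{i,r_i} | x_i ∈ F_j} facet by facet, and for each F_j in lexicographic order of the
-- choices r. For facets coming from F_i and F_j (i < j) with choices r_i and r_j, a witness
-- F_k for the pair (F_i, F_j) gives the witness F_k with choices r_j on F_j and r_i
-- elsewhere; inside the block of F_j, the lexicographic order of choices is itself a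
-- strong shelling order (a product of orders of singletons). Conversely, fix one copy
-- x_{i,r₀(i)} of every vertex. The facets of the expansion inside this copy are exactly
-- the copies of the facets of Δ, and a witness for two of them lies in the copy again, so
-- the subsequence of these facets is a strong shelling order of Δ. Throughout, the
-- shelling condition of a facet depends only on the set of facets before it.
module Submission where

open import Data.Bool as Bool using (Bool; true; false)
open import Data.Empty using (⊥-elim)
open import Data.Fin using (Fin; zero; suc; _<_; _↑ˡ_; _↑ʳ_; splitAt; fromℕ<)
open import Data.Fin.Properties using (splitAt-↑ˡ; splitAt-↑ʳ; splitAt⁻¹-↑ˡ; splitAt⁻¹-↑ʳ)
open import Data.Fin.Subset using (Subset; inside; outside; _∈_; _∉_; _⊆_; _─_; ∣_∣; ⊥; ⊤; ⁅_⁆)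
open import Data.Fin.Subset.Properties
  using ( _∈?_; _⊆?_; ⊆⊤; ⊆-antisym; ⊆-trans; ⊥⊆; ∉⊥; ∣⊥∣≡0; ∣⁅x⁆∣≡1; x∈⁅x⁆; x∈⁅y⁆⇒x≡y
        ; p─q⊆p; p─⊥≡p; x∈p∧x∉q⇒x∈p─q; out⊆; in⊆in; drop-∷-⊆; drop-there)
open import Data.List as List
  using (List; []; _∷_; length; map; concatMap; filter; deduplicate; cartesianProductWith)
open import Data.List.Membership.Propositional using (find; lose) renaming (_∈_ to _∈ˡ_)
open import Data.List.Membership.Propositional.Properties
  using ( ∈-map⁺; ∈-map⁻; ∈-cartesianProductWith⁺; ∈-cartesianProductWith⁻
        ; ∈-concatMap⁺; ∈-concatMap⁻; ∈-filter⁺; ∈-filter⁻; deduplicate-∈⇔)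
open import Data.List.Properties using (map-∘; map-id-local)
import Data.List.Relation.Unary.All as All
open import Data.List.Relation.Unary.Any using (here; there)
open import Data.List.Relation.Unary.Unique.DecPropositional.Properties using (deduplicate-!)
open import Data.Nat using (ℕ; zero; suc; _+_; _≤_; z≤n; s≤s)
open import Data.Product using (Σ; ∃-syntax; _×_; _,_; proj₁; proj₂; swap)
open import Data.Sum using (inj₁; inj₂; [_,_]; map₂)
open import Data.Unit using (tt) renaming (⊤ to Unit)
open import Data.Vec as Vec using (Vec; []; _∷_; _++_; lookup; sum)
open import Data.Vec.Properties using (≡-dec; zipWith-++; []=⇒lookup; lookup⇒[]=; lookup∘tabulate)
open import Function using (_∘_; id)
open import Function.Bundles using (_⇔_; mk⇔; Equivalence)
open import Level using (0ℓ)
open import Relation.Binary.PropositionalEquality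
  using (_≡_; refl; sym; trans; cong; cong₂; subst; subst₂; module ≡-Reasoning)
open import Relation.Nullary using (¬_; Dec; yes; no; contradiction)
open import Relation.Nullary.Decidable using (¬?; decidable-stable)
open import Relation.Unary using (Pred; Decidable; ∅; ｛_｝; _∪_; _∩_; _≐_)

open import Defs

open Equivalence using (to; from)

variable
  m n x : ℕ

-- Shelling relative to a set of earlier facets

Witness : (Fi Fj Fk : Subset m) → Set
Witness Fi Fj Fk = ∣ Fj ─ Fk ∣ ≡ 1 × Fj ─ Fk ⊆ Fj ─ Fi × Fk ─ Fj ⊆ Fi

ShelledBy : Pred (Subset m) 0ℓ → Subset m → Set
ShelledBy P Fj = ∀ Fi → P Fi → ∃[ Fk ] (P Fk × Witness Fi Fj Fk)

ShellingAfter : Pred (Subset m) 0ℓ → List (Subset m) → Set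
ShellingAfter P []       = Unit
ShellingAfter P (F ∷ Fs) = ShelledBy P F × ShellingAfter (｛ F ｝ ∪ P) Fs

IsShelling : List (Subset m) → Set
IsShelling = ShellingAfter ∅

module _ {P Q : Pred (Subset m) 0ℓ} where

  ShelledBy-resp : P ≐ Q → ∀ {F} → ShelledBy P F → ShelledBy Q F
  ShelledBy-resp (P⊆Q , Q⊆P) sh Fi q with sh Fi (Q⊆P q)
  ... | Fk , p , w = Fk , P⊆Q p , w

  ∪-respʳ-≐ : ∀ {F} → P ≐ Q → (｛ F ｝ ∪ P) ≐ (｛ F ｝ ∪ Q)
  ∪-respʳ-≐ (P⊆Q , Q⊆P) = map₂ P⊆Q , map₂ Q⊆P

ShellingAfter-resp : ∀ {P Q : Pred (Subset m) 0ℓ} → P ≐ Q →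
  ∀ Fs → ShellingAfter P Fs → ShellingAfter Q Fs
ShellingAfter-resp P≐Q []       _           = tt
ShellingAfter-resp P≐Q (F ∷ Fs) (sh , rest) =
  ShelledBy-resp P≐Q sh , ShellingAfter-resp (∪-respʳ-≐ P≐Q) Fs rest

Before : (L : List (Subset m)) → Fin (length L) → Pred (Subset m) 0ℓ
Before L j F = ∃[ i ] (i < j × List.lookup L i ≡ F)

module _ {P : Pred (Subset m) 0ℓ} {F : Subset m} {Fs : List (Subset m)} where

  before-zero : P ≐ (P ∪ Before (F ∷ Fs) zero)
  before-zero = inj₁ , [ id , (λ { (_ , () , _) }) ]

  before-suc : ∀ {j} → ((｛ F ｝ ∪ P) ∪ Before Fs j) ≐ (P ∪ Before (F ∷ Fs) (suc j))
  before-suc = (λ { (inj₁ (inj₁ refl))              → inj₂ (zero , s≤s z≤n , refl)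
                  ; (inj₁ (inj₂ p))                 → inj₁ p
                  ; (inj₂ (i , i<j , refl))         → inj₂ (suc i , s≤s i<j , refl) })
             , (λ { (inj₁ p)                        → inj₁ (inj₂ p)
                  ; (inj₂ (zero , _ , refl))        → inj₁ (inj₁ refl)
                  ; (inj₂ (suc i , s≤s i<j , refl)) → inj₂ (i , i<j , refl) })

shellingAfter⇔ : ∀ {P : Pred (Subset m) 0ℓ} L →
  ShellingAfter P L ⇔ (∀ j → ShelledBy (P ∪ Before L j) (List.lookup L j))
shellingAfter⇔ L = mk⇔ (pointwise L) (recursive L)
  where
  pointwise : ∀ {P} L → ShellingAfter P L → ∀ j → ShelledBy (P ∪ Before L j) (List.lookup L j)
  pointwise (F ∷ Fs) (sh , rest) zero    = ShelledBy-resp before-zero sh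
  pointwise (F ∷ Fs) (sh , rest) (suc j) = ShelledBy-resp before-suc (pointwise Fs rest j)
  recursive : ∀ {P} L → (∀ j → ShelledBy (P ∪ Before L j) (List.lookup L j)) → ShellingAfter P L
  recursive []       _  = tt
  recursive (F ∷ Fs) sh =
    ShelledBy-resp (swap before-zero) (sh zero) ,
    recursive Fs (λ j → ShelledBy-resp (swap before-suc) (sh (suc j)))

isShelling⇔isStrongShellingOrder : (L : List (Subset m)) → IsShelling L ⇔ IsStrongShellingOrder L
isShelling⇔isStrongShellingOrder L = mk⇔
  (λ sh i j i<j → earlierWitness (to (shellingAfter⇔ L) sh j) i<j)
  (λ sso → from (shellingAfter⇔ L) (shelledByEarlier sso))
  where
  earlierWitness : ∀ {i j} → ShelledBy (∅ ∪ Before L j) (List.lookup L j) → i < j →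
    ∃[ k ] (k < j × Witness (List.lookup L i) (List.lookup L j) (List.lookup L k))
  earlierWitness {i} sh i<j with sh _ (inj₂ (i , i<j , refl))
  ... | _ , inj₂ (k , k<j , refl) , w = k , k<j , w
  shelledByEarlier : IsStrongShellingOrder L → ∀ j → ShelledBy (∅ ∪ Before L j) (List.lookup L j)
  shelledByEarlier sso j _ (inj₂ (i , i<j , refl)) with sso i j i<j
  ... | k , k<j , w = List.lookup L k , inj₂ (k , k<j , refl) , w

shellingAfter-++ : ∀ {P : Pred (Subset m) 0ℓ} Fs {Gs} →
  ShellingAfter P Fs → ShellingAfter ((_∈ˡ Fs) ∪ P) Gs → ShellingAfter P (Fs List.++ Gs)
shellingAfter-++ []       _           rest = ShellingAfter-resp ([ (λ ()) , id ] , inj₂) _ rest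
shellingAfter-++ {m} {P} (F ∷ Fs) (sh , rest) more =
  sh , shellingAfter-++ Fs rest (ShellingAfter-resp reassoc _ more)
  where
  reassoc : ((_∈ˡ F ∷ Fs) ∪ P) ≐ ((_∈ˡ Fs) ∪ (｛ F ｝ ∪ P))
  reassoc = (λ { (inj₁ (here refl)) → inj₂ (inj₁ refl)
               ; (inj₁ (there G∈))  → inj₁ G∈
               ; (inj₂ p)           → inj₂ (inj₂ p) })
          , (λ { (inj₁ G∈)          → inj₁ (there G∈)
               ; (inj₂ (inj₁ refl)) → inj₁ (here refl)
               ; (inj₂ (inj₂ p))    → inj₂ p })

shellingAfter-∪ : ∀ {P Q : Pred (Subset m) 0ℓ} Fs →
  ShellingAfter P Fs → (∀ {F} → F ∈ˡ Fs → ShelledBy Q F) → ShellingAfter (Q ∪ P) Fs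
shellingAfter-∪ []       _           _   = tt
shellingAfter-∪ {m} {P} {Q} (F ∷ Fs) (sh , rest) byQ =
  shelled , ShellingAfter-resp reassoc Fs (shellingAfter-∪ Fs rest (byQ ∘ there))
  where
  shelled : ShelledBy (Q ∪ P) F
  shelled Fi (inj₁ q) = let Fk , q′ , w = byQ (here refl) Fi q in Fk , inj₁ q′ , w
  shelled Fi (inj₂ p) = let Fk , p′ , w = sh Fi p in Fk , inj₂ p′ , w
  reassoc : (Q ∪ (｛ F ｝ ∪ P)) ≐ (｛ F ｝ ∪ (Q ∪ P))
  reassoc = (λ { (inj₁ q) → inj₂ (inj₁ q) ; (inj₂ (inj₁ e)) → inj₁ e ; (inj₂ (inj₂ p)) → inj₂ (inj₂ p) })
          , (λ { (inj₁ e) → inj₂ (inj₁ e) ; (inj₂ (inj₁ q)) → inj₁ q ; (inj₂ (inj₂ p)) → inj₂ (inj₂ p) })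

BlockUnion : (Subset n → List (Subset m)) → Pred (Subset n) 0ℓ → Pred (Subset m) 0ℓ
BlockUnion B P G = ∃[ F ] (P F × G ∈ˡ B F)

LiftsShelledBy : (Subset n → List (Subset m)) → Set₁
LiftsShelledBy B = ∀ {P F} → ShelledBy P F → ∀ {G} → G ∈ˡ B F → ShelledBy (BlockUnion B P) G

shellingAfter-concatMap : ∀ {B : Subset n → List (Subset m)} →
  (∀ F → IsShelling (B F)) → LiftsShelledBy B →
  ∀ {P} Fs → ShellingAfter P Fs → ShellingAfter (BlockUnion B P) (concatMap B Fs)
shellingAfter-concatMap blocks lift []       _           = tt
shellingAfter-concatMap {B = B} blocks lift {P} (F ∷ Fs) (sh , rest) =
  shellingAfter-++ (B F) first (ShellingAfter-resp grow _ (shellingAfter-concatMap blocks lift Fs rest))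
  where
  first : ShellingAfter (BlockUnion B P) (B F)
  first = ShellingAfter-resp ([ id , (λ ()) ] , inj₁) (B F) (shellingAfter-∪ (B F) (blocks F) (lift sh))
  grow : BlockUnion B (｛ F ｝ ∪ P) ≐ ((_∈ˡ B F) ∪ BlockUnion B P)
  grow = (λ { (_ , inj₁ refl , G∈) → inj₁ G∈ ; (F′ , inj₂ p , G∈) → inj₂ (F′ , p , G∈) })
       , (λ { (inj₁ G∈) → F , inj₁ refl , G∈ ; (inj₂ (F′ , p , G∈)) → F′ , inj₂ p , G∈ })

isShelling-concatMap : ∀ {B : Subset n → List (Subset m)} →
  (∀ F → IsShelling (B F)) → LiftsShelledBy B →
  ∀ {Fs} → IsShelling Fs → IsShelling (concatMap B Fs)
isShelling-concatMap blocks lift {Fs} sh =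
  ShellingAfter-resp ((λ ()) , λ ()) _ (shellingAfter-concatMap blocks lift Fs sh)

Image : (Subset n → Subset m) → Pred (Subset n) 0ℓ → Pred (Subset m) 0ℓ
Image f P G = ∃[ F ] (P F × f F ≡ G)

module _ (f : Subset n → Subset m) where

  Image-∪ : ∀ {P F} → Image f (｛ F ｝ ∪ P) ≐ (｛ f F ｝ ∪ Image f P)
  Image-∪ {F = F} = (λ { (_ , inj₁ refl , refl) → inj₁ refl ; (F′ , inj₂ p , e) → inj₂ (F′ , p , e) })
                  , (λ { (inj₁ refl) → F , inj₁ refl , refl ; (inj₂ (F′ , p , e)) → F′ , inj₂ p , e })

  shellingAfter-map⁺ : (∀ {Fi Fj Fk} → Witness Fi Fj Fk → Witness (f Fi) (f Fj) (f Fk)) →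
    ∀ {P} Fs → ShellingAfter P Fs → ShellingAfter (Image f P) (map f Fs)
  shellingAfter-map⁺ preserves []       _           = tt
  shellingAfter-map⁺ preserves (F ∷ Fs) (sh , rest) =
    shelled , ShellingAfter-resp Image-∪ (map f Fs) (shellingAfter-map⁺ preserves Fs rest)
    where
    shelled : ShelledBy (Image f _) (f F)
    shelled _ (Fi , p , refl) = let Fk , p′ , w = sh Fi p in f Fk , (Fk , p′ , refl) , preserves w

  shellingAfter-map⁻ : (∀ {Fi Fj Fk} → Witness (f Fi) (f Fj) (f Fk) → Witness Fi Fj Fk) →
    ∀ {P} Fs → ShellingAfter (Image f P) (map f Fs) → ShellingAfter P Fs
  shellingAfter-map⁻ reflects []       _           = tt
  shellingAfter-map⁻ reflects (F ∷ Fs) (sh , rest) =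
    shelled , shellingAfter-map⁻ reflects Fs (ShellingAfter-resp (swap Image-∪) (map f Fs) rest)
    where
    shelled : ShelledBy _ F
    shelled Fi p with sh (f Fi) (Fi , p , refl)
    ... | _ , (Fk , p′ , refl) , w = Fk , p′ , reflects w

  isShelling-map⁺ : (∀ {Fi Fj Fk} → Witness Fi Fj Fk → Witness (f Fi) (f Fj) (f Fk)) →
    ∀ {Fs} → IsShelling Fs → IsShelling (map f Fs)
  isShelling-map⁺ preserves {Fs} sh =
    ShellingAfter-resp ((λ ()) , λ ()) _ (shellingAfter-map⁺ preserves Fs sh)

  isShelling-map⁻ : (∀ {Fi Fj Fk} → Witness (f Fi) (f Fj) (f Fk) → Witness Fi Fj Fk) →
    ∀ {Fs} → IsShelling (map f Fs) → IsShelling Fs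
  isShelling-map⁻ reflects {Fs} sh =
    shellingAfter-map⁻ reflects Fs (ShellingAfter-resp ((λ ()) , λ ()) _ sh)

module _ {D : Pred (Subset m) 0ℓ} (D? : Decidable D) where

  shellingAfter-filter : (∀ {Fi Fj Fk} → D Fi → D Fj → Witness Fi Fj Fk → D Fk) →
    ∀ {P} Fs → ShellingAfter P Fs → ShellingAfter (P ∩ D) (filter D? Fs)
  shellingAfter-filter closed []       _           = tt
  shellingAfter-filter closed {P} (F ∷ Fs) (sh , rest) with D? F
  ... | yes d = shelled , ShellingAfter-resp keep _ (shellingAfter-filter closed Fs rest)
    where
    shelled : ShelledBy (P ∩ D) F
    shelled Fi (p , dFi) = let Fk , p′ , w = sh Fi p in Fk , (p′ , closed dFi d w) , w
    keep : ((｛ F ｝ ∪ P) ∩ D) ≐ (｛ F ｝ ∪ (P ∩ D))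
    keep = (λ { (inj₁ e , _) → inj₁ e ; (inj₂ p , d′) → inj₂ (p , d′) })
         , (λ { (inj₁ refl) → inj₁ refl , d ; (inj₂ (p , d′)) → inj₂ p , d′ })
  ... | no ¬d = ShellingAfter-resp drop _ (shellingAfter-filter closed Fs rest)
    where
    drop : ((｛ F ｝ ∪ P) ∩ D) ≐ (P ∩ D)
    drop = (λ { (inj₁ refl , d) → ⊥-elim (¬d d) ; (inj₂ p , d) → p , d }) , (λ (p , d) → inj₂ p , d)

  isShelling-filter : (∀ {Fi Fj Fk} → D Fi → D Fj → Witness Fi Fj Fk → D Fk) →
    ∀ {Fs} → IsShelling Fs → IsShelling (filter D? Fs)
  isShelling-filter closed {Fs} sh =
    ShellingAfter-resp ((λ ()) , λ ()) _ (shellingAfter-filter closed Fs sh)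

  shellingAfter-filter-redundant : ∀ {P} → (∀ {G} → ¬ D G → P G) →
    ∀ Fs → ShellingAfter P Fs → ShellingAfter P (filter D? Fs)
  shellingAfter-filter-redundant redundant []       _           = tt
  shellingAfter-filter-redundant redundant (F ∷ Fs) (sh , rest) with D? F
  ... | yes _ = sh , shellingAfter-filter-redundant (inj₂ ∘ redundant) Fs rest
  ... | no ¬d = shellingAfter-filter-redundant redundant Fs (ShellingAfter-resp absorb Fs rest)
    where
    absorb : (｛ F ｝ ∪ _) ≐ _
    absorb = [ (λ { refl → redundant ¬d }) , id ] , inj₂

_≟_ : (F G : Subset m) → Dec (F ≡ G)
_≟_ = ≡-dec Bool._≟_

shellingAfter-deduplicate : ∀ {P : Pred (Subset m) 0ℓ} Fs →
  ShellingAfter P Fs → ShellingAfter P (deduplicate _≟_ Fs)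
shellingAfter-deduplicate []       _           = tt
shellingAfter-deduplicate (F ∷ Fs) (sh , rest) =
  sh , shellingAfter-filter-redundant (¬? ∘ (F ≟_)) (λ {G} ¬¬F≡G → inj₁ (decidable-stable (F ≟ G) ¬¬F≡G)) _
         (shellingAfter-deduplicate Fs rest)

-- Deduplicating is simpler than showing that the enumerations built below have no repetitions.
isShelling⇒stronglyShellable : ∀ {Facet : Subset m → Set} L →
  IsShelling L → (∀ F → F ∈ˡ L ⇔ Facet F) → StronglyShellableFacets Facet
isShelling⇒stronglyShellable L shelling mem =
  deduplicate _≟_ L ,
  deduplicate-! _≟_ L ,
  (λ F → mk⇔ (to (mem F) ∘ from (deduplicate-∈⇔ _≟_)) (to (deduplicate-∈⇔ _≟_) ∘ from (mem F))) ,
  to (isShelling⇔isStrongShellingOrder _) (shellingAfter-deduplicate L shelling)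

─-++ : (u u′ : Subset x) (w w′ : Subset m) → (u ++ w) ─ (u′ ++ w′) ≡ (u ─ u′) ++ (w ─ w′)
─-++ u u′ w w′ = zipWith-++ _ u w u′ w′

∣++∣ : (u : Subset x) (w : Subset m) → ∣ u ++ w ∣ ≡ ∣ u ∣ + ∣ w ∣
∣++∣ []            w = refl
∣++∣ (inside ∷ u)  w = cong suc (∣++∣ u w)
∣++∣ (outside ∷ u) w = ∣++∣ u w

⊆-++⁺ : ∀ {u u′ : Subset x} {w w′ : Subset m} → u ⊆ u′ → w ⊆ w′ → u ++ w ⊆ u′ ++ w′
⊆-++⁺ {u = []}          {[]}           _    w⊆w′ = w⊆w′
⊆-++⁺ {u = outside ∷ u} {_ ∷ u′}       u⊆u′ w⊆w′ = out⊆ (⊆-++⁺ (drop-∷-⊆ u⊆u′) w⊆w′)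
⊆-++⁺ {u = inside ∷ u}  {inside ∷ u′}  u⊆u′ w⊆w′ = in⊆in (⊆-++⁺ (drop-∷-⊆ u⊆u′) w⊆w′)
⊆-++⁺ {u = inside ∷ u}  {outside ∷ u′} u⊆u′ _    = contradiction (u⊆u′ Vec.here) λ ()

∈-++⁺ˡ : ∀ {j : Fin x} (u : Subset x) {w : Subset m} → j ∈ u → (j ↑ˡ m) ∈ u ++ w
∈-++⁺ˡ (_ ∷ u) Vec.here       = Vec.here
∈-++⁺ˡ (_ ∷ u) (Vec.there j∈) = Vec.there (∈-++⁺ˡ u j∈)

∈-++⁻ˡ : ∀ {j : Fin x} (u : Subset x) {w : Subset m} → (j ↑ˡ m) ∈ u ++ w → j ∈ u
∈-++⁻ˡ {j = zero}  (_ ∷ u) Vec.here       = Vec.here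
∈-++⁻ˡ {j = suc j} (_ ∷ u) (Vec.there j∈) = Vec.there (∈-++⁻ˡ u j∈)

∈-++⁺ʳ : ∀ {k : Fin m} (u : Subset x) {w : Subset m} → k ∈ w → (x ↑ʳ k) ∈ u ++ w
∈-++⁺ʳ []      k∈ = k∈
∈-++⁺ʳ (_ ∷ u) k∈ = Vec.there (∈-++⁺ʳ u k∈)

∈-++⁻ʳ : ∀ {k : Fin m} (u : Subset x) {w : Subset m} → (x ↑ʳ k) ∈ u ++ w → k ∈ w
∈-++⁻ʳ []      k∈             = k∈
∈-++⁻ʳ (_ ∷ u) (Vec.there k∈) = ∈-++⁻ʳ u k∈

x∈p─q⇒x∉q : ∀ {v : Fin n} (p q : Subset n) → v ∈ p ─ q → v ∉ q
x∈p─q⇒x∉q (_ ∷ p) (inside ∷ q)  (Vec.there v∈) (Vec.there v∈q) = x∈p─q⇒x∉q p q v∈ v∈q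
x∈p─q⇒x∉q (_ ∷ p) (outside ∷ q) (Vec.there v∈) (Vec.there v∈q) = x∈p─q⇒x∉q p q v∈ v∈q

p─p⊆q : ∀ {p q : Subset n} → p ─ p ⊆ q
p─p⊆q {p = p} v∈ = contradiction (p─q⊆p p p v∈) (x∈p─q⇒x∉q p p v∈)

∣p─p∣≡0 : (p : Subset n) → ∣ p ─ p ∣ ≡ 0
∣p─p∣≡0 {n} p = trans (cong ∣_∣ (⊆-antisym {i = p ─ p} p─p⊆q ⊥⊆)) (∣⊥∣≡0 n)

witness-self : ∀ {Fi Fj : Subset n} → ∣ Fj ─ Fi ∣ ≡ 1 → Witness Fi Fj Fi
witness-self {Fi = Fi} {Fj} card = card , id , p─q⊆p Fi Fj

witness-++ˡ : ∀ {Fi Fj Fk : Subset x} {G G′ : Subset m} →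
  Witness Fi Fj Fk → Witness (Fi ++ G′) (Fj ++ G) (Fk ++ G)
witness-++ˡ {Fi = Fi} {Fj} {Fk} {G} {G′} (card , sub , sub′) =
  card++ ,
  subst₂ _⊆_ (sym (─-++ Fj Fk G G)) (sym (─-++ Fj Fi G G′)) (⊆-++⁺ sub p─p⊆q) ,
  subst (_⊆ Fi ++ G′) (sym (─-++ Fk Fj G G)) (⊆-++⁺ sub′ p─p⊆q)
  where
  open ≡-Reasoning
  card++ : ∣ (Fj ++ G) ─ (Fk ++ G) ∣ ≡ 1
  card++ = begin
    ∣ (Fj ++ G) ─ (Fk ++ G) ∣  ≡⟨ cong ∣_∣ (─-++ Fj Fk G G) ⟩
    ∣ (Fj ─ Fk) ++ (G ─ G) ∣   ≡⟨ ∣++∣ (Fj ─ Fk) (G ─ G) ⟩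
    ∣ Fj ─ Fk ∣ + ∣ G ─ G ∣    ≡⟨ cong₂ _+_ card (∣p─p∣≡0 G) ⟩
    1                          ∎

witness-++ʳ : ∀ {F : Subset x} {Gi Gj Gk : Subset m} →
  Witness Gi Gj Gk → Witness (F ++ Gi) (F ++ Gj) (F ++ Gk)
witness-++ʳ {F = F} {Gi} {Gj} {Gk} (card , sub , sub′) =
  card++ ,
  subst₂ _⊆_ (sym (─-++ F F Gj Gk)) (sym (─-++ F F Gj Gi)) (⊆-++⁺ id sub) ,
  subst (_⊆ F ++ Gi) (sym (─-++ F F Gk Gj)) (⊆-++⁺ p─p⊆q sub′)
  where
  open ≡-Reasoning
  card++ : ∣ (F ++ Gj) ─ (F ++ Gk) ∣ ≡ 1
  card++ = begin
    ∣ (F ++ Gj) ─ (F ++ Gk) ∣  ≡⟨ cong ∣_∣ (─-++ F F Gj Gk) ⟩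
    ∣ (F ─ F) ++ (Gj ─ Gk) ∣   ≡⟨ ∣++∣ (F ─ F) (Gj ─ Gk) ⟩
    ∣ F ─ F ∣ + ∣ Gj ─ Gk ∣    ≡⟨ cong₂ _+_ (∣p─p∣≡0 F) card ⟩
    1                          ∎

witness-⊆ : ∀ {Fi Fj Fk Z : Subset n} → Fi ⊆ Z → Fj ⊆ Z → Witness Fi Fj Fk → Fk ⊆ Z
witness-⊆ {Fj = Fj} Fi⊆Z Fj⊆Z (_ , _ , sub′) {v} v∈ with v ∈? Fj
... | yes v∈Fj = Fj⊆Z v∈Fj
... | no  v∉Fj = Fi⊆Z (sub′ (x∈p∧x∉q⇒x∈p─q v∈ v∉Fj))

-- Lexicographic products of lists of facets

_⊗_ : List (Subset x) → List (Subset m) → List (Subset (x + m))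
_⊗_ = cartesianProductWith _++_

⊗≡concatMap : (U : List (Subset x)) (W : List (Subset m)) →
  U ⊗ W ≡ concatMap (λ u → map (u ++_) W) U
⊗≡concatMap []      W = refl
⊗≡concatMap (u ∷ U) W = cong (map (u ++_) W List.++_) (⊗≡concatMap U W)

⊗-isShelling : {U : List (Subset x)} {W : List (Subset m)} →
  IsShelling U → IsShelling W → IsShelling (U ⊗ W)
⊗-isShelling {U = U} {W} shU shW =
  subst IsShelling (sym (⊗≡concatMap U W)) (isShelling-concatMap blocks lift shU)
  where
  B : Subset _ → List (Subset _)
  B u = map (u ++_) W
  blocks : ∀ u → IsShelling (B u)
  blocks u = isShelling-map⁺ (u ++_) witness-++ʳ shW
  lift : LiftsShelledBy B
  lift {F = u} sh G∈ _ (u′ , p , Fi∈) with ∈-map⁻ (u ++_) G∈ | ∈-map⁻ (u′ ++_) Fi∈ | sh u′ p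
  ... | w , w∈ , refl | _ , _ , refl | c , p′ , wit =
    c ++ w , (c , p′ , ∈-map⁺ (c ++_) w∈) , witness-++ˡ wit

singletons : ∀ x → List (Subset x)
singletons zero    = []
singletons (suc x) = ⁅ zero ⁆ ∷ map (outside ∷_) (singletons x)

∈-singletons⁺ : (j : Fin x) → ⁅ j ⁆ ∈ˡ singletons x
∈-singletons⁺ zero    = here refl
∈-singletons⁺ (suc j) = there (∈-map⁺ (outside ∷_) (∈-singletons⁺ j))

∈-singletons⁻ : ∀ {F} → F ∈ˡ singletons x → ∃[ j ] F ≡ ⁅ j ⁆
∈-singletons⁻ {suc x} (here refl) = zero , refl
∈-singletons⁻ {suc x} (there F∈) with ∈-map⁻ (outside ∷_) F∈
... | G , G∈ , refl = let j , G≡ = ∈-singletons⁻ G∈ in suc j , cong (outside ∷_) G≡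

singletons-isShelling : ∀ x → IsShelling (singletons x)
singletons-isShelling zero    = tt
singletons-isShelling (suc x) =
  (λ _ ()) ,
  shellingAfter-∪ later
    (isShelling-map⁺ (outside ∷_) (witness-++ʳ {F = outside ∷ []}) (singletons-isShelling x))
    adjacent
  where
  later = map (outside ∷_) (singletons x)
  adjacent : ∀ {F} → F ∈ˡ later → ShelledBy ｛ ⁅ zero ⁆ ｝ F
  adjacent F∈ _ refl with ∈-map⁻ (outside ∷_) F∈
  ... | G , G∈ , refl with ∈-singletons⁻ G∈
  ... | j , refl = ⁅ zero ⁆ , refl , witness-self (trans (cong ∣_∣ (p─⊥≡p ⁅ j ⁆)) (∣⁅x⁆∣≡1 j))

block : Bool → Fin x → Subset x
block true  = ⁅_⁆
block false = λ _ → ⊥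

blockChoices : ∀ x → Bool → List (Subset x)
blockChoices x true  = singletons x
blockChoices x false = ⊥ ∷ []

blockChoices-isShelling : ∀ x b → IsShelling (blockChoices x b)
blockChoices-isShelling x true  = singletons-isShelling x
blockChoices-isShelling x false = (λ _ ()) , tt

∈-blockChoices⁺ : ∀ b (j : Fin x) → block b j ∈ˡ blockChoices x b
∈-blockChoices⁺ true  j = ∈-singletons⁺ j
∈-blockChoices⁺ false j = here refl

∈-blockChoices⁻ : ∀ b → Fin x → ∀ {u} → u ∈ˡ blockChoices x b → ∃[ j ] u ≡ block b j
∈-blockChoices⁻ true  _ u∈          = ∈-singletons⁻ u∈
∈-blockChoices⁻ false j (here refl) = j , refl

-- Expanded facets

Choice : Vec ℕ n → Set
Choice {n} s = (i : Fin n) → Fin (lookup s i)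

-- expand s F r = {x_{i, r i} | i ∈ F}, where, as in decode, the copies x_{i,1}, …, x_{i,s_i}
-- of x_i form the i-th block of Fin (sum s).
expand : (s : Vec ℕ n) → Subset n → Choice s → Subset (sum s)
expand []      []      r = []
expand (x ∷ s) (b ∷ F) r = block b (r zero) ++ expand s F (r ∘ suc)

expansions : (s : Vec ℕ n) → Subset n → List (Subset (sum s))
expansions []      []      = [] ∷ []
expansions (x ∷ s) (b ∷ F) = blockChoices x b ⊗ expansions s F

expansions-isShelling : (s : Vec ℕ n) (F : Subset n) → IsShelling (expansions s F)
expansions-isShelling []      []      = (λ _ ()) , tt
expansions-isShelling (x ∷ s) (b ∷ F) =
  ⊗-isShelling (blockChoices-isShelling x b) (expansions-isShelling s F)

∈-expansions⁺ : (s : Vec ℕ n) (F : Subset n) (r : Choice s) → expand s F r ∈ˡ expansions s F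
∈-expansions⁺ []      []      r = here refl
∈-expansions⁺ (x ∷ s) (b ∷ F) r =
  ∈-cartesianProductWith⁺ _++_ (∈-blockChoices⁺ b (r zero)) (∈-expansions⁺ s F (r ∘ suc))

-- The choice r₀ only supplies the coordinates outside F, which a Choice must also fill.
∈-expansions⁻ : (s : Vec ℕ n) (F : Subset n) → Choice s →
  ∀ {G} → G ∈ˡ expansions s F → ∃[ r ] G ≡ expand s F r
∈-expansions⁻ []      []      r₀ (here refl) = r₀ , refl
∈-expansions⁻ (x ∷ s) (b ∷ F) r₀ G∈
  with ∈-cartesianProductWith⁻ _++_ (blockChoices x b) (expansions s F) G∈
... | u , w , u∈ , w∈ , refl
  with ∈-blockChoices⁻ b (r₀ zero) u∈ | ∈-expansions⁻ s F (r₀ ∘ suc) w∈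
... | j , refl | r , refl = (λ { zero → j ; (suc i) → r i }) , refl

Chosen : (s : Vec ℕ n) → Subset n → Choice s → Σ (Fin n) (λ i → Fin (lookup s i)) → Set
Chosen s F r v = proj₁ v ∈ F × proj₂ v ≡ r (proj₁ v)

∈-expand⁻ : (s : Vec ℕ n) (F : Subset n) (r : Choice s) (v : Fin (sum s)) →
  v ∈ expand s F r → Chosen s F r (decode s v)
∈-expand⁻ (x ∷ s) (b ∷ F) r v v∈ with splitAt x v in eq
... | inj₁ j = head b (∈-++⁻ˡ (block b (r zero)) (subst (_∈ _) (sym (splitAt⁻¹-↑ˡ eq)) v∈))
  where
  head : ∀ b → j ∈ block b (r zero) → zero ∈ (b ∷ F) × j ≡ r zero
  head true  j∈ = Vec.here , x∈⁅y⁆⇒x≡y (r zero) j∈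
  head false j∈ = contradiction j∈ ∉⊥
... | inj₂ w =
  let w∈ = ∈-++⁻ʳ (block b (r zero)) (subst (_∈ _) (sym (splitAt⁻¹-↑ʳ eq)) v∈)
      i∈ , j≡ = ∈-expand⁻ s F (r ∘ suc) w w∈
  in Vec.there i∈ , j≡

∈-expand⁺ : (s : Vec ℕ n) (F : Subset n) (r : Choice s) (v : Fin (sum s)) →
  Chosen s F r (decode s v) → v ∈ expand s F r
∈-expand⁺ (x ∷ s) (b ∷ F) r v chosen with splitAt x v in eq
∈-expand⁺ (x ∷ s) (true ∷ F) r v (_ , j≡) | inj₁ j =
  subst (_∈ _) (splitAt⁻¹-↑ˡ eq) (∈-++⁺ˡ ⁅ r zero ⁆ (subst (λ k → j ∈ ⁅ k ⁆) j≡ (x∈⁅x⁆ j)))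
... | inj₂ w =
  subst (_∈ _) (splitAt⁻¹-↑ʳ eq)
    (∈-++⁺ʳ (block b (r zero)) (∈-expand⁺ s F (r ∘ suc) w (drop-there (proj₁ chosen) , proj₂ chosen)))

vertex : (s : Vec ℕ n) (i : Fin n) → Fin (lookup s i) → Fin (sum s)
vertex (x ∷ s) zero    j = j ↑ˡ sum s
vertex (x ∷ s) (suc i) j = x ↑ʳ vertex s i j

decode-vertex : (s : Vec ℕ n) (i : Fin n) (j : Fin (lookup s i)) → decode s (vertex s i j) ≡ (i , j)
decode-vertex (x ∷ s) zero    j rewrite splitAt-↑ˡ x j (sum s) = refl
decode-vertex (x ∷ s) (suc i) j rewrite splitAt-↑ʳ x (sum s) (vertex s i j) | decode-vertex s i j = refl

∣expand∣ : (s : Vec ℕ n) (F : Subset n) (r : Choice s) → ∣ expand s F r ∣ ≡ ∣ F ∣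
∣expand∣ []      []          r = refl
∣expand∣ (x ∷ s) (true ∷ F)  r =
  trans (∣++∣ ⁅ r zero ⁆ _) (cong₂ _+_ (∣⁅x⁆∣≡1 (r zero)) (∣expand∣ s F (r ∘ suc)))
∣expand∣ (x ∷ s) (false ∷ F) r =
  trans (∣++∣ (⊥ {n = x}) _) (cong₂ _+_ (∣⊥∣≡0 x) (∣expand∣ s F (r ∘ suc)))

restrict : (s : Vec ℕ n) → Choice s → Subset (sum s) → Subset n
restrict s r G = Vec.tabulate (λ i → lookup G (vertex s i (r i)))

module _ (s : Vec ℕ n) where

  AgreeOn : Subset n → Choice s → Choice s → Set
  AgreeOn X r r′ = ∀ {i} → i ∈ X → r i ≡ r′ i

  ∈-expand-vertex⁻ : ∀ {F r i j} → vertex s i j ∈ expand s F r → i ∈ F × j ≡ r i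
  ∈-expand-vertex⁻ {F} {r} {i} {j} v∈ =
    subst (Chosen s F r) (decode-vertex s i j) (∈-expand⁻ s F r _ v∈)

  ∈-expand-vertex⁺ : ∀ {F r i} → i ∈ F → vertex s i (r i) ∈ expand s F r
  ∈-expand-vertex⁺ {F} {r} {i} i∈ =
    ∈-expand⁺ s F r _ (subst (Chosen s F r) (sym (decode-vertex s i (r i))) (i∈ , refl))

  expand-⊆⁻ : ∀ {X Y r r′} → expand s X r ⊆ expand s Y r′ → ∀ {i} → i ∈ X → i ∈ Y × r i ≡ r′ i
  expand-⊆⁻ sub i∈ = ∈-expand-vertex⁻ (sub (∈-expand-vertex⁺ i∈))

  expand-mono : ∀ {X Y r r′} → X ⊆ Y → AgreeOn X r r′ → expand s X r ⊆ expand s Y r′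
  expand-mono {X} {Y} {r} {r′} X⊆Y agree {v} v∈ =
    let i∈ , j≡ = ∈-expand⁻ s X r v v∈ in ∈-expand⁺ s Y r′ v (X⊆Y i∈ , trans j≡ (agree i∈))

  expand-cong : ∀ {X r r′} → AgreeOn X r r′ → expand s X r ≡ expand s X r′
  expand-cong agree = ⊆-antisym (expand-mono id agree) (expand-mono id (sym ∘ agree))

  expand-─⊆ : ∀ {X Y r r′} → expand s (X ─ Y) r ⊆ expand s X r ─ expand s Y r′
  expand-─⊆ {X} {Y} {r} {r′} {v} v∈ =
    let i∈ , j≡ = ∈-expand⁻ s (X ─ Y) r v v∈ in
    x∈p∧x∉q⇒x∈p─q (∈-expand⁺ s X r v (p─q⊆p X Y i∈ , j≡))
                   (λ v∈Y → x∈p─q⇒x∉q X Y i∈ (proj₁ (∈-expand⁻ s Y r′ v v∈Y)))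

  expand-─ : ∀ {X Y r r′} → (∀ {i} → i ∈ X → i ∈ Y → r i ≡ r′ i) →
    expand s X r ─ expand s Y r′ ≡ expand s (X ─ Y) r
  expand-─ {X} {Y} {r} {r′} agree = ⊆-antisym sub expand-─⊆
    where
    sub : expand s X r ─ expand s Y r′ ⊆ expand s (X ─ Y) r
    sub {v} v∈ =
      let i∈X , j≡ = ∈-expand⁻ s X r v (p─q⊆p _ _ v∈)
          i∉Y = λ i∈Y → x∈p─q⇒x∉q _ _ v∈ (∈-expand⁺ s Y r′ v (i∈Y , trans j≡ (agree i∈X i∈Y)))
      in ∈-expand⁺ s (X ─ Y) r v (x∈p∧x∉q⇒x∈p─q i∈X i∉Y , j≡)

  override : Subset n → Choice s → Choice s → Choice s
  override F r r′ i with i ∈? F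
  ... | yes _ = r i
  ... | no  _ = r′ i

  override-∈ : ∀ {F r r′ i} → i ∈ F → override F r r′ i ≡ r i
  override-∈ {F} {i = i} i∈ with i ∈? F
  ... | yes _ = refl
  ... | no i∉ = contradiction i∈ i∉

  override-∉ : ∀ {F r r′ i} → i ∉ F → override F r r′ i ≡ r′ i
  override-∉ {F} {i = i} i∉ with i ∈? F
  ... | yes i∈ = contradiction i∈ i∉
  ... | no _   = refl

  expand-witness : ∀ {Fi Fj Fk ri rj} → Witness Fi Fj Fk →
    Witness (expand s Fi ri) (expand s Fj rj) (expand s Fk (override Fj rj ri))
  expand-witness {Fi} {Fj} {Fk} {ri} {rj} (card , sub , sub′) =
    card′ ,
    subst (_⊆ _) (sym jk) (⊆-trans (expand-mono sub (λ _ → refl)) expand-─⊆) ,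
    subst (_⊆ _) (sym kj) (expand-mono sub′ (λ i∈ → override-∉ (x∈p─q⇒x∉q Fk Fj i∈)))
    where
    open ≡-Reasoning
    rk = override Fj rj ri
    jk : expand s Fj rj ─ expand s Fk rk ≡ expand s (Fj ─ Fk) rj
    jk = expand-─ (λ i∈Fj _ → sym (override-∈ i∈Fj))
    kj : expand s Fk rk ─ expand s Fj rj ≡ expand s (Fk ─ Fj) rk
    kj = expand-─ (λ _ i∈Fj → override-∈ i∈Fj)
    card′ : ∣ expand s Fj rj ─ expand s Fk rk ∣ ≡ 1
    card′ = begin
      ∣ expand s Fj rj ─ expand s Fk rk ∣  ≡⟨ cong ∣_∣ jk ⟩
      ∣ expand s (Fj ─ Fk) rj ∣            ≡⟨ ∣expand∣ s (Fj ─ Fk) rj ⟩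
      ∣ Fj ─ Fk ∣                          ≡⟨ card ⟩
      1                                    ∎

  expand-witness⁻ : ∀ {Fi Fj Fk r} →
    Witness (expand s Fi r) (expand s Fj r) (expand s Fk r) → Witness Fi Fj Fk
  expand-witness⁻ {Fi} {Fj} {Fk} {r} (card , sub , sub′) =
    card′ ,
    proj₁ ∘ expand-⊆⁻ (subst₂ _⊆_ (─′ Fj Fk) (─′ Fj Fi) sub) ,
    proj₁ ∘ expand-⊆⁻ (subst (_⊆ _) (─′ Fk Fj) sub′)
    where
    open ≡-Reasoning
    ─′ : ∀ X Y → expand s X r ─ expand s Y r ≡ expand s (X ─ Y) r
    ─′ X Y = expand-─ (λ _ _ → refl)
    card′ : ∣ Fj ─ Fk ∣ ≡ 1
    card′ = begin
      ∣ Fj ─ Fk ∣                        ≡⟨ ∣expand∣ s (Fj ─ Fk) r ⟨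
      ∣ expand s (Fj ─ Fk) r ∣           ≡⟨ cong ∣_∣ (─′ Fj Fk) ⟨
      ∣ expand s Fj r ─ expand s Fk r ∣  ≡⟨ card ⟩
      1                                  ∎

  ∈-restrict⁻ : ∀ {r G i} → i ∈ restrict s r G → vertex s i (r i) ∈ G
  ∈-restrict⁻ {r} {G} {i} i∈ =
    lookup⇒[]= _ G (trans (sym (lookup∘tabulate _ i)) ([]=⇒lookup i∈))

  ∈-restrict⁺ : ∀ {r G i} → vertex s i (r i) ∈ G → i ∈ restrict s r G
  ∈-restrict⁺ {r} {G} {i} v∈ =
    lookup⇒[]= i _ (trans (lookup∘tabulate _ i) ([]=⇒lookup v∈))

  restrict-expand : ∀ F r → restrict s r (expand s F r) ≡ F
  restrict-expand F r =
    ⊆-antisym (proj₁ ∘ ∈-expand-vertex⁻ ∘ ∈-restrict⁻) (∈-restrict⁺ ∘ ∈-expand-vertex⁺)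

expansions-liftsShelledBy : (s : Vec ℕ n) → Choice s → LiftsShelledBy (expansions s)
expansions-liftsShelledBy s r₀ {F = F} sh G∈ _ (F′ , p , Fi∈)
  with ∈-expansions⁻ s F r₀ G∈ | ∈-expansions⁻ s F′ r₀ Fi∈ | sh F′ p
... | r , refl | r′ , refl | Fk , p′ , w =
  expand s Fk (override s F r r′) , (Fk , p′ , ∈-expansions⁺ s Fk _) , expand-witness s w

-- The two directions

module _ (Δ : SimplicialComplex n) (s : Vec ℕ n) where

  ExpandedFacet : Subset (sum s) → Set
  ExpandedFacet G = ∃[ F ] ∃[ r ] (IsFacet Δ F × G ≡ expand s F r)

  isExpansionFacet⇔ : ∀ {G} → IsExpansionFacet Δ s G ⇔ ExpandedFacet G
  isExpansionFacet⇔ = mk⇔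
    (λ (F , r , facet , char) → F , r , facet ,
       ⊆-antisym (λ {v} → ∈-expand⁺ s F r v ∘ to (char v)) (λ {v} → from (char v) ∘ ∈-expand⁻ s F r v))
    (λ { (F , r , facet , refl) → F , r , facet , λ v → mk⇔ (∈-expand⁻ s F r v) (∈-expand⁺ s F r v) })

  restrict-expansionFacet : ∀ {r₀ G} → IsExpansionFacet Δ s G → G ⊆ expand s ⊤ r₀ →
    IsFacet Δ (restrict s r₀ G) × expand s (restrict s r₀ G) r₀ ≡ G
  restrict-expansionFacet {r₀} G-facet G⊆ with to isExpansionFacet⇔ G-facet
  ... | F , r , F-facet , refl =
    subst (IsFacet Δ) (sym restricted) F-facet ,
    trans (cong (λ X → expand s X r₀) restricted) (sym r≈r₀)
    where
    r≈r₀ : expand s F r ≡ expand s F r₀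
    r≈r₀ = expand-cong s (proj₂ ∘ expand-⊆⁻ s G⊆)
    restricted : restrict s r₀ (expand s F r) ≡ F
    restricted = trans (cong (restrict s r₀) r≈r₀) (restrict-expand s F r₀)

  module _ (r₀ : Choice s) where

    stronglyShellable⇒expansion : StronglyShellable Δ → ExpansionStronglyShellable Δ s
    stronglyShellable⇒expansion (L , _ , mem , sso) =
      isShelling⇒stronglyShellable E
        (isShelling-concatMap (expansions-isShelling s) (expansions-liftsShelledBy s r₀)
          (from (isShelling⇔isStrongShellingOrder L) sso))
        (λ G → mk⇔ expansionFacet (enumerated ∘ to isExpansionFacet⇔))
      where
      E = concatMap (expansions s) L
      expansionFacet : ∀ {G} → G ∈ˡ E → IsExpansionFacet Δ s G
      expansionFacet G∈ with find (∈-concatMap⁻ (expansions s) {xs = L} G∈)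
      ... | F , F∈ , G∈F with ∈-expansions⁻ s F r₀ G∈F
      ... | r , refl = from isExpansionFacet⇔ (F , r , to (mem F) F∈ , refl)
      enumerated : ∀ {G} → ExpandedFacet G → G ∈ˡ E
      enumerated (F , r , facet , refl) =
        ∈-concatMap⁺ (expansions s) (lose (from (mem F) facet) (∈-expansions⁺ s F r))

    expansion⇒stronglyShellable : ExpansionStronglyShellable Δ s → StronglyShellable Δ
    expansion⇒stronglyShellable (L′ , _ , mem′ , sso′) =
      isShelling⇒stronglyShellable L
        (isShelling-map⁻ (λ F → expand s F r₀) (expand-witness⁻ s)
          (subst IsShelling (sym reexpand)
            (isShelling-filter (_⊆? Z) witness-⊆ (from (isShelling⇔isStrongShellingOrder L′) sso′))))
        (λ F → mk⇔ facet enumerated)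
      where
      Z = expand s ⊤ r₀
      L₀ = filter (_⊆? Z) L′
      L = map (restrict s r₀) L₀
      restrict-L₀ : ∀ {G} → G ∈ˡ L₀ → IsFacet Δ (restrict s r₀ G) × expand s (restrict s r₀ G) r₀ ≡ G
      restrict-L₀ G∈ = let G∈L′ , G⊆Z = ∈-filter⁻ (_⊆? Z) G∈ in
        restrict-expansionFacet (to (mem′ _) G∈L′) G⊆Z
      reexpand : map (λ F → expand s F r₀) L ≡ L₀
      reexpand = trans (sym (map-∘ L₀)) (map-id-local (All.tabulate (proj₂ ∘ restrict-L₀)))
      facet : ∀ {F} → F ∈ˡ L → IsFacet Δ F
      facet F∈ with ∈-map⁻ (restrict s r₀) F∈
      ... | G , G∈ , refl = proj₁ (restrict-L₀ G∈)
      enumerated : ∀ {F} → IsFacet Δ F → F ∈ˡ L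
      enumerated {F} F-facet = subst (_∈ˡ L) (restrict-expand s F r₀)
        (∈-map⁺ (restrict s r₀) (∈-filter⁺ (_⊆? Z)
          (from (mem′ _) (from isExpansionFacet⇔ (F , r₀ , F-facet , refl)))
          (expand-mono s ⊆⊤ (λ _ → refl))))

theorem2p18 : (n : ℕ) (Δ : SimplicialComplex n) (s : Vec ℕ n) →
    (∀ (i : Fin n) → 1 ≤ lookup s i) →
    StronglyShellable Δ ⇔ ExpansionStronglyShellable Δ s
theorem2p18 n Δ s positive =
  mk⇔ (stronglyShellable⇒expansion Δ s r₀) (expansion⇒stronglyShellable Δ s r₀)
  where
  -- Positivity of the s_i is used only here, to pick one copy x_{i,r₀(i)} of every vertex.
  r₀ : Choice s
  r₀ i = fromℕ< (positive i)
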